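{- Let $q\in\mathbb{C}$ with $0<|q|<1$, $d\in\mathbb{C}$ with $d\neq q^2$, and $j\ge0$ an integer. Then \[ \sum_{n=0}^{j} {j \brack n}_q \left(\frac{d}{q}\right)_{j-n} \left(\frac{ -d}{q}\right)^n q^{n(n-1)/2}=\frac{(q)_j}{1-d/q^2} \sum_{t=0}^{j+1} \sum_{n=0}^{t} \frac{(2n-t)(d/q^2)_n(d/q^2)_{t-n}(-1)^{j+1-t}q^{(t-n)+(j-t)(j-t+1)/2}}{(q)_n(q)_{t-n}(q)_{j+1-t}}. \]
   Context: $(A)_n=(A;q)_n=\prod_{i=0}^{n-1}(1-Aq^i)$; ${j \brack n}_q=\frac{(q)_j}{(q)_n(q)_{j-n}}$ is the Gaussian binomial coefficient. -}

module Defs where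

open import Level using (Level; _⊔_) renaming (suc to lsuc)
open import Data.Nat using (ℕ; zero; suc)
open import Relation.Nullary using (¬_)
open import Algebra.Bundles using (CommutativeRing)

record Field (c ℓ : Level) : Set (lsuc (c ⊔ ℓ)) where
  field
    commutativeRing : CommutativeRing c ℓ
  open CommutativeRing commutativeRing public
  field
    _⁻¹       : Carrier → Carrier
    0≉1       : ¬ (0# ≈ 1#)
    ⁻¹-inverse : ∀ x → ¬ (x ≈ 0#) → x * (x ⁻¹) ≈ 1#

module FieldOps {c ℓ : Level} (F : Field c ℓ) where
  open Field F public hiding (zero)

  pow : Carrier → ℕ → Carrier
  pow x zero    = 1#
  pow x (suc n) = pow x n * x

  ι : ℕ → Carrier
  ι zero    = 0#
  ι (suc n) = 1# + ι n

  qPoch : Carrier → Carrier → ℕ → Carrier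
  qPoch a q zero    = 1#
  qPoch a q (suc n) = qPoch a q n * (1# - a * pow q n)

  gauss : Carrier → ℕ → ℕ → Carrier
  gauss q j n = qPoch q q j * ((qPoch q q n * qPoch q q (j Data.Nat.∸ n)) ⁻¹)

  sumTo : ℕ → (ℕ → Carrier) → Carrier
  sumTo zero    f = f zero
  sumTo (suc n) f = sumTo n f + f (suc n)

module Submission where

-- Everything is an identity between formal power series, with D = d/q². In product
-- notation (never used below), a = Σ (D)ₙ/(q)ₙ zⁿ = (Dz)∞/(z)∞, b(z) = a(qz) and
-- (xz)∞ = Σ (-x)ⁿ q^(n(n-1)/2)/(q)ₙ zⁿ. The left side is (q)ⱼ [zʲ] (Dqz)∞ (Dqz)∞/(z)∞;
-- the right side is (q)ⱼ/(1 - D) [zʲ⁺¹] (z)∞ W with W = θa·b - a·θb, θ = z d/dz.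
-- Each series is characterised by a first-order q-difference equation, such as
-- (1 - z) a = (1 - Dz) b. Applying θ to that equation gives (1 - z)² W = (1 - D) z b²,
-- and since (z)∞ b = (1 - z)(Dqz)∞ and b = (1 - z)(Dqz)∞/(z)∞, both (1 - z)²(z)∞ W and
-- (1 - z)²(1 - D) z (Dqz)∞²/(z)∞ equal (1 - D) z (z)∞ b²; cancelling (1 - z)² finishes.
-- The identity (z)∞ b = (1 - z)(Dqz)∞ is the one place where q^k ≠ 1 enters: both sides
-- satisfy the same q-difference equation, whose solution with constant term 0 is 0.

open import Defs
open import Algebra.Bundles using (CommutativeRing)
open import Algebra.Structures using (IsCommutativeRing)
open import Data.Nat as ℕ using (ℕ; zero; suc; _∸_; _≤_; z≤n; s≤s; ⌊_/2⌋) renaming (_*_ to _*ℕ_; _+_ to _+ℕ_)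
import Data.Nat.Properties as ℕ
open import Data.Integer as ℤ using (ℤ; +_; -[1+_])
import Data.Integer.Properties as ℤ
open import Data.Sign as Sign using (Sign)
open import Data.Maybe using (Maybe; just; nothing)
open import Data.Product using (_,_)
open import Data.Sum using (inj₁; inj₂)
open import Relation.Nullary using (¬_; yes; no)
open import Relation.Binary.PropositionalEquality as ≡ using (_≡_)
import Relation.Binary.Reasoning.Setoid
import Algebra.Solver.Ring.AlmostCommutativeRing as ACR

triangle : ℕ → ℕ
triangle zero    = 0
triangle (suc n) = n +ℕ triangle n

n*[1+n]≡2*triangle[1+n] : ∀ n → n *ℕ suc n ≡ triangle (suc n) +ℕ triangle (suc n)
n*[1+n]≡2*triangle[1+n] zero    = ≡.refl
n*[1+n]≡2*triangle[1+n] (suc n) = begin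
  suc n *ℕ suc (suc n)                 ≡⟨ solve 1 (λ n → (con 1 :+ n) :* (con 2 :+ n) := n :* (con 1 :+ n) :+ (con 2 :+ (n :+ n))) ≡.refl n ⟩
  n *ℕ suc n +ℕ (2 +ℕ (n +ℕ n))     ≡⟨ ≡.cong (ℕ._+ (2 +ℕ (n +ℕ n))) (n*[1+n]≡2*triangle[1+n] n) ⟩
  (t +ℕ t) +ℕ (2 +ℕ (n +ℕ n))       ≡⟨ solve 2 (λ n t → (t :+ t) :+ (con 2 :+ (n :+ n)) := (con 1 :+ n :+ t) :+ (con 1 :+ n :+ t)) ≡.refl n t ⟩
  triangle (suc (suc n)) +ℕ triangle (suc (suc n)) ∎
  where
  open ≡.≡-Reasoning
  open import Data.Nat.Solver using (module +-*-Solver)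
  open +-*-Solver
  t : ℕ
  t = triangle (suc n)

⌊n*[1+n]/2⌋≡triangle[1+n] : ∀ n → ⌊ n *ℕ suc n /2⌋ ≡ triangle (suc n)
⌊n*[1+n]/2⌋≡triangle[1+n] n =
  ≡.trans (≡.cong ⌊_/2⌋ (n*[1+n]≡2*triangle[1+n] n)) (≡.sym (ℕ.n≡⌊n+n/2⌋ (triangle (suc n))))

⌊n*[n∸1]/2⌋≡triangle : ∀ n → ⌊ n *ℕ (n ∸ 1) /2⌋ ≡ triangle n
⌊n*[n∸1]/2⌋≡triangle zero    = ≡.refl
⌊n*[n∸1]/2⌋≡triangle (suc n) = ≡.trans (≡.cong ⌊_/2⌋ (ℕ.*-comm (suc n) n)) (⌊n*[1+n]/2⌋≡triangle[1+n] n)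

⌊[n∸1]*suc[n∸1]/2⌋≡triangle : ∀ n → ⌊ (n ∸ 1) *ℕ suc (n ∸ 1) /2⌋ ≡ triangle n
⌊[n∸1]*suc[n∸1]/2⌋≡triangle zero    = ≡.refl
⌊[n∸1]*suc[n∸1]/2⌋≡triangle (suc n) = ⌊n*[1+n]/2⌋≡triangle[1+n] n

m∸n≡[1+m∸n]∸1 : ∀ m n → m ∸ n ≡ suc m ∸ n ∸ 1
m∸n≡[1+m∸n]∸1 m n = ≡.trans (≡.cong (suc m ∸_) (ℕ.+-comm 1 n)) (≡.sym (ℕ.∸-+-assoc (suc m) n 1))

-- The ring solver needs a coefficient ring mapped into R; the integers make
-- subtraction normalise in an arbitrary commutative ring.
module IntegerCoefficients {c ℓ} (R : CommutativeRing c ℓ) where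
  open CommutativeRing R
  open import Algebra.Properties.Ring ring using (-0#≈0#; -‿involutive; -‿+-comm; -‿distribˡ-*; -‿distribʳ-*)
  open import Algebra.Properties.Semiring.Mult.TCOptimised semiring using (_×_; 1+×; ×-homo-+; ×1-homo-*)
  open import Relation.Binary.Reasoning.Setoid setoid

  signed : Sign → Carrier → Carrier
  signed Sign.+ x = x
  signed Sign.- x = - x

  ⟦_⟧ : ℤ → Carrier
  ⟦ i ⟧ = signed (ℤ.sign i) (ℤ.∣ i ∣ × 1#)

  ⟦s◃n⟧ : ∀ s n → ⟦ s ℤ.◃ n ⟧ ≈ signed s (n × 1#)
  ⟦s◃n⟧ Sign.+ zero    = refl
  ⟦s◃n⟧ Sign.- zero    = sym -0#≈0#
  ⟦s◃n⟧ Sign.+ (suc n) = refl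
  ⟦s◃n⟧ Sign.- (suc n) = refl

  signed-* : ∀ s t x y → signed (s Sign.* t) (x * y) ≈ signed s x * signed t y
  signed-* Sign.+ Sign.+ x y = refl
  signed-* Sign.+ Sign.- x y = -‿distribʳ-* x y
  signed-* Sign.- Sign.+ x y = -‿distribˡ-* x y
  signed-* Sign.- Sign.- x y = trans (sym (-‿involutive _)) (trans (-‿cong (-‿distribˡ-* x y)) (-‿distribʳ-* (- x) y))

  ⟦-‿⟧ : ∀ i → ⟦ ℤ.- i ⟧ ≈ - ⟦ i ⟧
  ⟦-‿⟧ (+ zero)  = sym -0#≈0#
  ⟦-‿⟧ (+ suc n) = refl
  ⟦-‿⟧ -[1+ n ]  = sym (-‿involutive _)

  [1+x]-[1+y]≈x-y : ∀ x y → (1# + x) - (1# + y) ≈ x - y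
  [1+x]-[1+y]≈x-y x y = begin
    (1# + x) - (1# + y)    ≈⟨ +-congˡ (sym (-‿+-comm 1# y)) ⟩
    (1# + x) + (- 1# - y)  ≈⟨ +-assoc 1# x _ ⟩
    1# + (x + (- 1# - y))  ≈⟨ +-congˡ (trans (sym (+-assoc x _ _)) (trans (+-congʳ (+-comm x _)) (+-assoc _ x _))) ⟩
    1# + (- 1# + (x - y))  ≈⟨ sym (+-assoc 1# _ _) ⟩
    (1# - 1#) + (x - y)    ≈⟨ +-congʳ (-‿inverseʳ 1#) ⟩
    0# + (x - y)           ≈⟨ +-identityˡ _ ⟩
    x - y                  ∎

  ⟦m⊖n⟧ : ∀ m n → ⟦ m ℤ.⊖ n ⟧ ≈ m × 1# - n × 1#
  ⟦m⊖n⟧ zero    zero    = sym (-‿inverseʳ 0#)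
  ⟦m⊖n⟧ (suc m) zero    = sym (trans (+-congˡ -0#≈0#) (+-identityʳ _))
  ⟦m⊖n⟧ zero    (suc n) = sym (+-identityˡ _)
  ⟦m⊖n⟧ (suc m) (suc n) = begin
    ⟦ suc m ℤ.⊖ suc n ⟧             ≡⟨ ≡.cong ⟦_⟧ (ℤ.[1+m]⊖[1+n]≡m⊖n m n) ⟩
    ⟦ m ℤ.⊖ n ⟧                     ≈⟨ ⟦m⊖n⟧ m n ⟩
    m × 1# - n × 1#                 ≈⟨ sym ([1+x]-[1+y]≈x-y _ _) ⟩
    (1# + m × 1#) - (1# + n × 1#)   ≈⟨ sym (+-cong (1+× m 1#) (-‿cong (1+× n 1#))) ⟩
    suc m × 1# - suc n × 1#         ∎

  ⟦+⟧ : ∀ i j → ⟦ i ℤ.+ j ⟧ ≈ ⟦ i ⟧ + ⟦ j ⟧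
  ⟦+⟧ (+ m)    (+ n)    = ×-homo-+ 1# m n
  ⟦+⟧ (+ m)    -[1+ n ] = ⟦m⊖n⟧ m (suc n)
  ⟦+⟧ -[1+ m ] (+ n)    = trans (⟦m⊖n⟧ n (suc m)) (+-comm _ _)
  ⟦+⟧ -[1+ m ] -[1+ n ] = begin
    - (suc (suc (m +ℕ n)) × 1#)    ≡⟨ ≡.cong (λ k → - (suc k × 1#)) (≡.sym (ℕ.+-suc m n)) ⟩
    - ((suc m +ℕ suc n) × 1#)      ≈⟨ -‿cong (×-homo-+ 1# (suc m) (suc n)) ⟩
    - (suc m × 1# + suc n × 1#)    ≈⟨ sym (-‿+-comm _ _) ⟩
    - (suc m × 1#) - (suc n × 1#)  ∎

  ⟦*⟧ : ∀ i j → ⟦ i ℤ.* j ⟧ ≈ ⟦ i ⟧ * ⟦ j ⟧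
  ⟦*⟧ i j = begin
    ⟦ i ℤ.* j ⟧                                    ≈⟨ ⟦s◃n⟧ s (ℤ.∣ i ∣ *ℕ ℤ.∣ j ∣) ⟩
    signed s ((ℤ.∣ i ∣ *ℕ ℤ.∣ j ∣) × 1#)           ≈⟨ signed-cong s (×1-homo-* ℤ.∣ i ∣ ℤ.∣ j ∣) ⟩
    signed s ((ℤ.∣ i ∣ × 1#) * (ℤ.∣ j ∣ × 1#))     ≈⟨ signed-* (ℤ.sign i) (ℤ.sign j) _ _ ⟩
    ⟦ i ⟧ * ⟦ j ⟧                                  ∎
    where
    s : Sign
    s = ℤ.sign i Sign.* ℤ.sign j
    signed-cong : ∀ s {x y} → x ≈ y → signed s x ≈ signed s y
    signed-cong Sign.+ x≈y = x≈y
    signed-cong Sign.- x≈y = -‿cong x≈y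

  homomorphism : ACR._-Raw-AlmostCommutative⟶_ ℤ.+-*-rawRing (ACR.fromCommutativeRing R)
  homomorphism = record
    { ⟦_⟧ = ⟦_⟧ ; +-homo = ⟦+⟧ ; *-homo = ⟦*⟧ ; -‿homo = ⟦-‿⟧
    ; 0-homo = refl ; 1-homo = refl }

  private
    coefficient≟ : ∀ i j → Maybe (⟦ i ⟧ ≈ ⟦ j ⟧)
    coefficient≟ i j with i ℤ.≟ j
    ... | yes ≡.refl = just refl
    ... | no _       = nothing

  open import Algebra.Solver.Ring ℤ.+-*-rawRing (ACR.fromCommutativeRing R) homomorphism coefficient≟ public
    using (solve; _:=_; _:+_; _:*_; :-_; _:-_; con)

module FieldProperties {c ℓ} (F : Field c ℓ) where
  open FieldOps F
  open import Algebra.Properties.Ring ring using (-0#≈0#; x∙y⁻¹≈ε⇒x≈y)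
  open import Relation.Binary.Reasoning.Setoid setoid
  private module Scalar = IntegerCoefficients commutativeRing
  open Scalar using (_:*_; _:-_; _:=_; con)

  ⁻¹-inverseˡ : ∀ x → ¬ (x ≈ 0#) → x ⁻¹ * x ≈ 1#
  ⁻¹-inverseˡ x x≉0 = trans (*-comm _ _) (⁻¹-inverse x x≉0)

  ⁻¹-unique : ∀ {x y} → ¬ (x ≈ 0#) → x * y ≈ 1# → y ≈ x ⁻¹
  ⁻¹-unique {x} {y} x≉0 xy≈1 = begin
    y                ≈⟨ sym (*-identityˡ y) ⟩
    1# * y           ≈⟨ *-congʳ (sym (⁻¹-inverseˡ x x≉0)) ⟩
    (x ⁻¹ * x) * y   ≈⟨ *-assoc _ _ _ ⟩
    x ⁻¹ * (x * y)   ≈⟨ *-congˡ xy≈1 ⟩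
    x ⁻¹ * 1#        ≈⟨ *-identityʳ _ ⟩
    x ⁻¹             ∎

  *-cancelʳ : ∀ {u x y} → ¬ (u ≈ 0#) → x * u ≈ y * u → x ≈ y
  *-cancelʳ {u} {x} {y} u≉0 xu≈yu = begin
    x                 ≈⟨ sym (*-identityʳ x) ⟩
    x * 1#            ≈⟨ *-congˡ (sym (⁻¹-inverse u u≉0)) ⟩
    x * (u * u ⁻¹)    ≈⟨ sym (*-assoc _ _ _) ⟩
    (x * u) * u ⁻¹    ≈⟨ *-congʳ xu≈yu ⟩
    (y * u) * u ⁻¹    ≈⟨ *-assoc _ _ _ ⟩
    y * (u * u ⁻¹)    ≈⟨ *-congˡ (⁻¹-inverse u u≉0) ⟩
    y * 1#            ≈⟨ *-identityʳ y ⟩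
    y                 ∎

  x*u≈0⇒x≈0 : ∀ {u x} → ¬ (u ≈ 0#) → x * u ≈ 0# → x ≈ 0#
  x*u≈0⇒x≈0 u≉0 xu≈0 = *-cancelʳ u≉0 (trans xu≈0 (sym (zeroˡ _)))

  *-nonzero : ∀ {x y} → ¬ (x ≈ 0#) → ¬ (y ≈ 0#) → ¬ (x * y ≈ 0#)
  *-nonzero x≉0 y≉0 xy≈0 = x≉0 (x*u≈0⇒x≈0 y≉0 xy≈0)

  x-y*z≈x : ∀ {x z} y → z ≈ 0# → x - y * z ≈ x
  x-y*z≈x {x} {z} y z≈0 = begin
    x - y * z     ≈⟨ +-congˡ (-‿cong (trans (*-congˡ z≈0) (zeroʳ y))) ⟩
    x - 0#        ≈⟨ +-congˡ -0#≈0# ⟩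
    x + 0#        ≈⟨ +-identityʳ x ⟩
    x             ∎

  1≉0 : ¬ (1# ≈ 0#)
  1≉0 1≈0 = 0≉1 (sym 1≈0)

  1-x≉0 : ∀ {x} → ¬ (x ≈ 1#) → ¬ (1# - x ≈ 0#)
  1-x≉0 x≉1 1-x≈0 = x≉1 (sym (x∙y⁻¹≈ε⇒x≈y _ _ 1-x≈0))

  pow-nonzero : ∀ {x} → ¬ (x ≈ 0#) → ∀ n → ¬ (pow x n ≈ 0#)
  pow-nonzero x≉0 zero    = 1≉0
  pow-nonzero x≉0 (suc n) = *-nonzero (pow-nonzero x≉0 n) x≉0

  1⁻¹≈1 : 1# ⁻¹ ≈ 1#
  1⁻¹≈1 = sym (⁻¹-unique 1≉0 (*-identityˡ 1#))

  ⁻¹-distrib-* : ∀ {x y} → ¬ (x ≈ 0#) → ¬ (y ≈ 0#) → (x * y) ⁻¹ ≈ x ⁻¹ * y ⁻¹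
  ⁻¹-distrib-* {x} {y} x≉0 y≉0 = sym (⁻¹-unique (*-nonzero x≉0 y≉0) (begin
    (x * y) * (x ⁻¹ * y ⁻¹)     ≈⟨ *-cong (*-comm x y) refl ⟩
    (y * x) * (x ⁻¹ * y ⁻¹)     ≈⟨ *-assoc _ _ _ ⟩
    y * (x * (x ⁻¹ * y ⁻¹))     ≈⟨ *-congˡ (sym (*-assoc _ _ _)) ⟩
    y * ((x * x ⁻¹) * y ⁻¹)     ≈⟨ *-congˡ (*-congʳ (⁻¹-inverse x x≉0)) ⟩
    y * (1# * y ⁻¹)             ≈⟨ *-congˡ (*-identityˡ _) ⟩
    y * y ⁻¹                    ≈⟨ ⁻¹-inverse y y≉0 ⟩
    1#                          ∎))

  x*y≈[x*u⁻¹]*[u*y] : ∀ {x y u} → ¬ (u ≈ 0#) → x * y ≈ (x * u ⁻¹) * (u * y)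
  x*y≈[x*u⁻¹]*[u*y] {x} {y} {u} u≉0 = sym (begin
    (x * u ⁻¹) * (u * y)     ≈⟨ Scalar.solve 4 (λ x y u i → (x :* i) :* (u :* y) := (x :* y) :* (i :* u)) refl x y u (u ⁻¹) ⟩
    (x * y) * (u ⁻¹ * u)     ≈⟨ *-congˡ (⁻¹-inverseˡ u u≉0) ⟩
    (x * y) * 1#             ≈⟨ *-identityʳ _ ⟩
    x * y                    ∎)

  pow-cong : ∀ {x y} n → x ≈ y → pow x n ≈ pow y n
  pow-cong zero    x≈y = refl
  pow-cong (suc n) x≈y = *-cong (pow-cong n x≈y) x≈y

  pow-+ : ∀ x m n → pow x (m +ℕ n) ≈ pow x m * pow x n
  pow-+ x m zero    = trans (reflexive (≡.cong (pow x) (ℕ.+-identityʳ m))) (sym (*-identityʳ _))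
  pow-+ x m (suc n) = trans (reflexive (≡.cong (pow x) (ℕ.+-suc m n))) (trans (*-congʳ (pow-+ x m n)) (*-assoc _ _ _))

  qPoch-cong : ∀ {a b} q n → a ≈ b → qPoch a q n ≈ qPoch b q n
  qPoch-cong q zero    a≈b = refl
  qPoch-cong q (suc n) a≈b = *-cong (qPoch-cong q n a≈b) (+-congˡ (-‿cong (*-congʳ a≈b)))

  qPoch-suc-shift : ∀ x q n → qPoch x q (suc n) ≈ (1# - x) * qPoch (x * q) q n
  qPoch-suc-shift x q zero    = Scalar.solve 1 (λ x → con (+ 1) :* (con (+ 1) :- x :* con (+ 1)) := (con (+ 1) :- x) :* con (+ 1)) refl x
  qPoch-suc-shift x q (suc n) = begin
    qPoch x q (suc n) * (1# - x * pow q (suc n))                  ≈⟨ *-congʳ (qPoch-suc-shift x q n) ⟩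
    (1# - x) * qPoch (x * q) q n * (1# - x * (pow q n * q))       ≈⟨ Scalar.solve 4 (λ x q P r → (con (+ 1) :- x) :* P :* (con (+ 1) :- x :* (r :* q)) := (con (+ 1) :- x) :* (P :* (con (+ 1) :- x :* q :* r))) refl x q (qPoch (x * q) q n) (pow q n) ⟩
    (1# - x) * qPoch (x * q) q (suc n)                            ∎

  ι-+ : ∀ m n → ι (m +ℕ n) ≈ ι m + ι n
  ι-+ zero    n = sym (+-identityˡ _)
  ι-+ (suc m) n = trans (+-congˡ (ι-+ m n)) (sym (+-assoc _ _ _))

module FiniteSums {c ℓ} (F : Field c ℓ) where
  open FieldOps F
  open import Relation.Binary.Reasoning.Setoid setoid
  open import Algebra.Properties.Ring ring using (-‿+-comm)

  sumTo-cong : ∀ n {f g : ℕ → Carrier} → (∀ i → i ≤ n → f i ≈ g i) → sumTo n f ≈ sumTo n g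
  sumTo-cong zero    f≈g = f≈g 0 z≤n
  sumTo-cong (suc n) f≈g = +-cong (sumTo-cong n (λ i i≤n → f≈g i (ℕ.m≤n⇒m≤1+n i≤n))) (f≈g (suc n) ℕ.≤-refl)

  sumTo-zero : ∀ n {f : ℕ → Carrier} → (∀ i → i ≤ n → f i ≈ 0#) → sumTo n f ≈ 0#
  sumTo-zero zero    f≈0 = f≈0 0 z≤n
  sumTo-zero (suc n) f≈0 = trans (+-cong (sumTo-zero n (λ i i≤n → f≈0 i (ℕ.m≤n⇒m≤1+n i≤n))) (f≈0 (suc n) ℕ.≤-refl)) (+-identityˡ 0#)

  sumTo-distrib-+ : ∀ n (f g : ℕ → Carrier) → sumTo n (λ i → f i + g i) ≈ sumTo n f + sumTo n g
  sumTo-distrib-+ zero    f g = refl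
  sumTo-distrib-+ (suc n) f g = begin
    sumTo n (λ i → f i + g i) + (f (suc n) + g (suc n)) ≈⟨ +-congʳ (sumTo-distrib-+ n f g) ⟩
    (sumTo n f + sumTo n g) + (f (suc n) + g (suc n))   ≈⟨ +-assoc _ _ _ ⟩
    sumTo n f + (sumTo n g + (f (suc n) + g (suc n)))   ≈⟨ +-congˡ (trans (sym (+-assoc _ _ _)) (trans (+-congʳ (+-comm _ _)) (+-assoc _ _ _))) ⟩
    sumTo n f + (f (suc n) + (sumTo n g + g (suc n)))   ≈⟨ sym (+-assoc _ _ _) ⟩
    (sumTo n f + f (suc n)) + (sumTo n g + g (suc n))   ∎

  *-distribˡ-sumTo : ∀ n x (f : ℕ → Carrier) → x * sumTo n f ≈ sumTo n (λ i → x * f i)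
  *-distribˡ-sumTo zero    x f = refl
  *-distribˡ-sumTo (suc n) x f = trans (distribˡ _ _ _) (+-congʳ (*-distribˡ-sumTo n x f))

  *-distribʳ-sumTo : ∀ n x (f : ℕ → Carrier) → sumTo n f * x ≈ sumTo n (λ i → f i * x)
  *-distribʳ-sumTo n x f = trans (*-comm _ _) (trans (*-distribˡ-sumTo n x f) (sumTo-cong n (λ i _ → *-comm _ _)))

  -‿distrib-sumTo : ∀ n (f : ℕ → Carrier) → - sumTo n f ≈ sumTo n (λ i → - f i)
  -‿distrib-sumTo zero    f = refl
  -‿distrib-sumTo (suc n) f = trans (sym (-‿+-comm _ _)) (+-congʳ (-‿distrib-sumTo n f))

  sumTo-suc-head : ∀ n (f : ℕ → Carrier) → sumTo (suc n) f ≈ f 0 + sumTo n (λ i → f (suc i))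
  sumTo-suc-head zero    f = refl
  sumTo-suc-head (suc n) f = trans (+-congʳ (sumTo-suc-head n f)) (+-assoc _ _ _)

  sumTo-reverse : ∀ n (f : ℕ → Carrier) → sumTo n f ≈ sumTo n (λ i → f (n ∸ i))
  sumTo-reverse zero    f = refl
  sumTo-reverse (suc n) f = begin
    sumTo n f + f (suc n)                     ≈⟨ +-congʳ (sumTo-reverse n f) ⟩
    sumTo n (λ i → f (n ∸ i)) + f (suc n)     ≈⟨ +-comm _ _ ⟩
    f (suc n) + sumTo n (λ i → f (n ∸ i))     ≈⟨ sym (sumTo-suc-head n (λ i → f (suc n ∸ i))) ⟩
    sumTo (suc n) (λ i → f (suc n ∸ i))       ∎

  sumTo-triangle : ∀ n (h : ℕ → ℕ → Carrier) →
    sumTo n (λ i → sumTo i (h i)) ≈ sumTo n (λ j → sumTo (n ∸ j) (λ k → h (j +ℕ k) j))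
  sumTo-triangle zero    h = refl
  sumTo-triangle (suc n) h = begin
    sumTo n (λ i → sumTo i (h i)) + sumTo (suc n) (h (suc n))
      ≈⟨ +-congʳ (sumTo-triangle n h) ⟩
    sumTo n inner + (sumTo n (h (suc n)) + h (suc n) (suc n))
      ≈⟨ sym (+-assoc _ _ _) ⟩
    (sumTo n inner + sumTo n (h (suc n))) + h (suc n) (suc n)
      ≈⟨ +-cong (sym (sumTo-distrib-+ n inner (h (suc n)))) (reflexive (≡.cong (λ m → h m (suc n)) (≡.sym (ℕ.+-identityʳ (suc n))))) ⟩
    sumTo n (λ j → inner j + h (suc n) j) + h (suc n +ℕ 0) (suc n)
      ≈⟨ +-cong (sumTo-cong n extend) (reflexive (≡.cong (λ m → sumTo m (λ k → h (suc n +ℕ k) (suc n))) (≡.sym (ℕ.n∸n≡0 n)))) ⟩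
    sumTo (suc n) (λ j → sumTo (suc n ∸ j) (λ k → h (j +ℕ k) j)) ∎
    where
    inner : ℕ → Carrier
    inner j = sumTo (n ∸ j) (λ k → h (j +ℕ k) j)
    extend : ∀ j → j ≤ n → inner j + h (suc n) j ≈ sumTo (suc n ∸ j) (λ k → h (j +ℕ k) j)
    extend j j≤n rewrite ℕ.+-∸-assoc 1 j≤n =
      +-congˡ (reflexive (≡.cong (λ m → h m j) (≡.trans (≡.sym (ℕ.m+[n∸m]≡n (ℕ.m≤n⇒m≤1+n j≤n))) (≡.cong (j +ℕ_) (ℕ.+-∸-assoc 1 j≤n)))))

module PowerSeries {c ℓ} (F : Field c ℓ) where
  open FieldOps F
  open FieldProperties F
  open FiniteSums F
  open import Algebra.Properties.Ring ring using (-0#≈0#; -‿distribʳ-*; x∙y⁻¹≈ε⇒x≈y)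
  open import Relation.Binary.Reasoning.Setoid setoid
  private module Scalar = IntegerCoefficients commutativeRing
  open Scalar using (_:+_; _:*_; _:-_; _:=_; con)

  Series : Set c
  Series = ℕ → Carrier

  infix  4 _≋_
  infixl 6 _⊕_
  infixl 7 _⊛_
  infix  8 ⊝_

  _≋_ : Series → Series → Set ℓ
  f ≋ g = ∀ n → f n ≈ g n

  _⊕_ : Series → Series → Series
  (f ⊕ g) n = f n + g n

  ⊝_ : Series → Series
  (⊝ f) n = - f n

  𝟘 : Series
  𝟘 n = 0#

  𝟙 : Series
  𝟙 zero    = 1#
  𝟙 (suc n) = 0#

  _⊛_ : Series → Series → Series
  (f ⊛ g) n = sumTo n (λ i → f i * g (n ∸ i))

  ⊛-cong : ∀ {f f′ g g′} → f ≋ f′ → g ≋ g′ → f ⊛ g ≋ f′ ⊛ g′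
  ⊛-cong f≋f′ g≋g′ n = sumTo-cong n (λ i _ → *-cong (f≋f′ i) (g≋g′ (n ∸ i)))

  ⊛-congˡ : ∀ f {g g′} → g ≋ g′ → f ⊛ g ≋ f ⊛ g′
  ⊛-congˡ f = ⊛-cong {f} {f} (λ _ → refl)

  ⊛-congʳ : ∀ g {f f′} → f ≋ f′ → f ⊛ g ≋ f′ ⊛ g
  ⊛-congʳ g f≋f′ = ⊛-cong {g = g} {g′ = g} f≋f′ (λ _ → refl)

  ⊛-comm : ∀ f g → f ⊛ g ≋ g ⊛ f
  ⊛-comm f g n = begin
    sumTo n (λ i → f i * g (n ∸ i))               ≈⟨ sumTo-reverse n _ ⟩
    sumTo n (λ i → f (n ∸ i) * g (n ∸ (n ∸ i)))   ≈⟨ sumTo-cong n (λ i i≤n → trans (*-comm _ _) (*-congʳ (reflexive (≡.cong g (ℕ.m∸[m∸n]≡n i≤n))))) ⟩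
    sumTo n (λ i → g i * f (n ∸ i))               ∎

  ⊛-assoc : ∀ f g h → (f ⊛ g) ⊛ h ≋ f ⊛ (g ⊛ h)
  ⊛-assoc f g h n = begin
    sumTo n (λ i → sumTo i (λ j → f j * g (i ∸ j)) * h (n ∸ i))
      ≈⟨ sumTo-cong n (λ i _ → *-distribʳ-sumTo i _ _) ⟩
    sumTo n (λ i → sumTo i (λ j → f j * g (i ∸ j) * h (n ∸ i)))
      ≈⟨ sumTo-triangle n _ ⟩
    sumTo n (λ j → sumTo (n ∸ j) (λ k → f j * g ((j +ℕ k) ∸ j) * h (n ∸ (j +ℕ k))))
      ≈⟨ sumTo-cong n (λ j _ → sumTo-cong (n ∸ j) (λ k _ → trans (*-assoc _ _ _) (*-congˡ (*-cong
           (reflexive (≡.cong g (ℕ.m+n∸m≡n j k))) (reflexive (≡.cong h (≡.sym (ℕ.∸-+-assoc n j k)))))))) ⟩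
    sumTo n (λ j → sumTo (n ∸ j) (λ k → f j * (g k * h (n ∸ j ∸ k))))
      ≈⟨ sumTo-cong n (λ j _ → sym (*-distribˡ-sumTo (n ∸ j) _ _)) ⟩
    sumTo n (λ j → f j * sumTo (n ∸ j) (λ k → g k * h (n ∸ j ∸ k))) ∎

  ⊛-identityˡ : ∀ f → 𝟙 ⊛ f ≋ f
  ⊛-identityˡ f zero    = *-identityˡ _
  ⊛-identityˡ f (suc n) = begin
    sumTo (suc n) (λ i → 𝟙 i * f (suc n ∸ i))                ≈⟨ sumTo-suc-head n _ ⟩
    1# * f (suc n) + sumTo n (λ i → 0# * f (n ∸ i))          ≈⟨ +-cong (*-identityˡ _) (sumTo-zero n (λ i _ → zeroˡ _)) ⟩
    f (suc n) + 0#                                           ≈⟨ +-identityʳ _ ⟩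
    f (suc n)                                                ∎

  ⊛-distribʳ : ∀ f g h → (g ⊕ h) ⊛ f ≋ g ⊛ f ⊕ h ⊛ f
  ⊛-distribʳ f g h n = trans (sumTo-cong n (λ i _ → distribʳ _ _ _)) (sumTo-distrib-+ n _ _)

  ⊛-isCommutativeRing : IsCommutativeRing _≋_ _⊕_ _⊛_ ⊝_ 𝟘 𝟙
  ⊛-isCommutativeRing = record
    { isRing = record
      { +-isAbelianGroup = record
        { isGroup = record
          { isMonoid = record
            { isSemigroup = record
              { isMagma = record
                { isEquivalence = record
                  { refl = λ n → refl ; sym = λ f≋g n → sym (f≋g n) ; trans = λ f≋g g≋h n → trans (f≋g n) (g≋h n) }
                ; ∙-cong = λ f≋f′ g≋g′ n → +-cong (f≋f′ n) (g≋g′ n) }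
              ; assoc = λ f g h n → +-assoc _ _ _ }
            ; identity = (λ f n → +-identityˡ _) , (λ f n → +-identityʳ _) }
          ; inverse = (λ f n → -‿inverseˡ _) , (λ f n → -‿inverseʳ _)
          ; ⁻¹-cong = λ f≋g n → -‿cong (f≋g n) }
        ; comm = λ f g n → +-comm _ _ }
      ; *-cong = ⊛-cong
      ; *-assoc = ⊛-assoc
      ; *-identity = ⊛-identityˡ , (λ f n → trans (⊛-comm f 𝟙 n) (⊛-identityˡ f n))
      ; distrib = (λ f g h n → trans (⊛-comm f (g ⊕ h) n) (trans (⊛-distribʳ f g h n) (+-cong (⊛-comm g f n) (⊛-comm h f n))))
                , ⊛-distribʳ }
    ; *-comm = ⊛-comm }

  seriesRing : CommutativeRing c ℓ
  seriesRing = record { isCommutativeRing = ⊛-isCommutativeRing }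

  X : Series
  X zero          = 0#
  X (suc zero)    = 1#
  X (suc (suc n)) = 0#

  κ : Carrier → Series
  κ x zero    = x
  κ x (suc n) = 0#

  X⊛-zero : ∀ f → (X ⊛ f) 0 ≈ 0#
  X⊛-zero f = zeroˡ _

  X⊛-suc : ∀ f n → (X ⊛ f) (suc n) ≈ f n
  X⊛-suc f n = begin
    sumTo (suc n) (λ i → X i * f (suc n ∸ i))         ≈⟨ sumTo-suc-head n _ ⟩
    0# * f (suc n) + sumTo n (λ i → X (suc i) * f (n ∸ i)) ≈⟨ trans (+-congʳ (zeroˡ _)) (+-identityˡ _) ⟩
    sumTo n (λ i → X (suc i) * f (n ∸ i))              ≈⟨ sumTo-cong n (λ i _ → *-congʳ (X-shift i)) ⟩
    sumTo n (λ i → 𝟙 i * f (n ∸ i))                    ≈⟨ ⊛-identityˡ f n ⟩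
    f n                                                ∎
    where
    X-shift : ∀ i → X (suc i) ≈ 𝟙 i
    X-shift zero    = refl
    X-shift (suc i) = refl

  κ⊛ : ∀ x f n → (κ x ⊛ f) n ≈ x * f n
  κ⊛ x f zero    = refl
  κ⊛ x f (suc n) = begin
    sumTo (suc n) (λ i → κ x i * f (suc n ∸ i))         ≈⟨ sumTo-suc-head n _ ⟩
    x * f (suc n) + sumTo n (λ i → 0# * f (n ∸ i))      ≈⟨ +-congˡ (sumTo-zero n (λ i _ → zeroˡ _)) ⟩
    x * f (suc n) + 0#                                  ≈⟨ +-identityʳ _ ⟩
    x * f (suc n)                                       ∎

  κ1⊛ : ∀ f → κ 1# ⊛ f ≋ f
  κ1⊛ f n = trans (κ⊛ 1# f n) (*-identityˡ _)

  open CommutativeRing seriesRing public using ()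
    renaming (refl to ≋-refl; sym to ≋-sym; trans to ≋-trans; +-cong to ⊕-cong; -‿cong to ⊝-cong)
  module ≋-Reasoning = Relation.Binary.Reasoning.Setoid (CommutativeRing.setoid seriesRing)

  private module SeriesSolver = IntegerCoefficients seriesRing
  open SeriesSolver using () renaming (_:*_ to _⊠_; _:-_ to _⊟_; _:=_ to _≐_; con to scon)

  [1-_z] : Carrier → Series
  [1- x z] = 𝟙 ⊕ ⊝ (κ x ⊛ X)

  [1-xz]⊛-expand : ∀ x f → [1- x z] ⊛ f ≋ f ⊕ ⊝ (κ x ⊛ (X ⊛ f))
  [1-xz]⊛-expand x f = SeriesSolver.solve 3 (λ f k z → (scon (+ 1) ⊟ k ⊠ z) ⊠ f ≐ f ⊟ k ⊠ (z ⊠ f)) (λ _ → refl) f (κ x) X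

  [1-xz]⊛-zero : ∀ x f → ([1- x z] ⊛ f) 0 ≈ f 0
  [1-xz]⊛-zero x f = begin
    ([1- x z] ⊛ f) 0               ≈⟨ [1-xz]⊛-expand x f 0 ⟩
    f 0 - (κ x ⊛ (X ⊛ f)) 0        ≈⟨ +-congˡ (-‿cong (trans (κ⊛ x (X ⊛ f) 0) (trans (*-congˡ (X⊛-zero f)) (zeroʳ x)))) ⟩
    f 0 - 0#                       ≈⟨ trans (+-congˡ -0#≈0#) (+-identityʳ _) ⟩
    f 0                            ∎

  [1-xz]⊛-suc : ∀ x f n → ([1- x z] ⊛ f) (suc n) ≈ f (suc n) - x * f n
  [1-xz]⊛-suc x f n = trans ([1-xz]⊛-expand x f (suc n)) (+-congˡ (-‿cong (trans (κ⊛ x (X ⊛ f) (suc n)) (*-congˡ (X⊛-suc f n)))))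

  [1-xz]⊛-cancel : ∀ x {f g} → [1- x z] ⊛ f ≋ [1- x z] ⊛ g → f ≋ g
  [1-xz]⊛-cancel x {f} {g} eq n = x∙y⁻¹≈ε⇒x≈y (f n) (g n) (difference≈0 n)
    where
    difference≈0 : ∀ n → (f ⊕ ⊝ g) n ≈ 0#
    [1-xz]⊛difference≈0 : [1- x z] ⊛ (f ⊕ ⊝ g) ≋ 𝟘
    [1-xz]⊛difference≈0 n = trans
      (SeriesSolver.solve 3 (λ l f g → l ⊠ (f ⊟ g) ≐ l ⊠ f ⊟ l ⊠ g) (λ _ → refl) [1- x z] f g n)
      (trans (+-congʳ (eq n)) (-‿inverseʳ _))
    difference≈0 zero    = trans (sym ([1-xz]⊛-zero x (f ⊕ ⊝ g))) ([1-xz]⊛difference≈0 0)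
    difference≈0 (suc n) = begin
      (f ⊕ ⊝ g) (suc n)                                         ≈⟨ x∙y⁻¹≈ε⇒x≈y _ _ (trans (sym ([1-xz]⊛-suc x (f ⊕ ⊝ g) n)) ([1-xz]⊛difference≈0 (suc n))) ⟩
      x * (f ⊕ ⊝ g) n                                           ≈⟨ *-congˡ (difference≈0 n) ⟩
      x * 0#                                                    ≈⟨ zeroʳ x ⟩
      0#                                                        ∎

  θ : Series → Series
  θ f n = ι n * f n

  θ-⊕ : ∀ f g → θ (f ⊕ g) ≋ θ f ⊕ θ g
  θ-⊕ f g n = distribˡ _ _ _

  θ-⊝ : ∀ f → θ (⊝ f) ≋ ⊝ θ f
  θ-⊝ f n = sym (-‿distribʳ-* _ _)

  θ-⊛ : ∀ f g → θ (f ⊛ g) ≋ θ f ⊛ g ⊕ f ⊛ θ g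
  θ-⊛ f g n = begin
    ι n * sumTo n (λ i → f i * g (n ∸ i))                     ≈⟨ *-distribˡ-sumTo n _ _ ⟩
    sumTo n (λ i → ι n * (f i * g (n ∸ i)))                   ≈⟨ sumTo-cong n split ⟩
    sumTo n (λ i → ι i * f i * g (n ∸ i) + f i * (ι (n ∸ i) * g (n ∸ i))) ≈⟨ sumTo-distrib-+ n _ _ ⟩
    (θ f ⊛ g ⊕ f ⊛ θ g) n                                     ∎
    where
    split : ∀ i → i ≤ n → ι n * (f i * g (n ∸ i)) ≈ ι i * f i * g (n ∸ i) + f i * (ι (n ∸ i) * g (n ∸ i))
    split i i≤n = begin
      ι n * (f i * g (n ∸ i))                                 ≈⟨ *-congʳ (trans (reflexive (≡.cong ι (≡.sym (ℕ.m+[n∸m]≡n i≤n)))) (ι-+ i (n ∸ i))) ⟩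
      (ι i + ι (n ∸ i)) * (f i * g (n ∸ i))                   ≈⟨ Scalar.solve 4 (λ a b x y → (a :+ b) :* (x :* y) := a :* x :* y :+ x :* (b :* y)) refl (ι i) (ι (n ∸ i)) (f i) (g (n ∸ i)) ⟩
      ι i * f i * g (n ∸ i) + f i * (ι (n ∸ i) * g (n ∸ i))   ∎

  θ-κ⊛ : ∀ x f → θ (κ x ⊛ f) ≋ κ x ⊛ θ f
  θ-κ⊛ x f n = begin
    ι n * (κ x ⊛ f) n      ≈⟨ *-congˡ (κ⊛ x f n) ⟩
    ι n * (x * f n)        ≈⟨ trans (sym (*-assoc _ _ _)) (trans (*-congʳ (*-comm _ _)) (*-assoc _ _ _)) ⟩
    x * (ι n * f n)        ≈⟨ sym (κ⊛ x (θ f) n) ⟩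
    (κ x ⊛ θ f) n          ∎

  θ-[1-xz] : ∀ x → θ [1- x z] ≋ ⊝ (κ x ⊛ X)
  θ-[1-xz] x n = begin
    θ [1- x z] n                          ≈⟨ θ-⊕ 𝟙 (⊝ (κ x ⊛ X)) n ⟩
    θ 𝟙 n + θ (⊝ (κ x ⊛ X)) n             ≈⟨ +-cong (θ𝟙 n) (trans (θ-⊝ (κ x ⊛ X) n) (-‿cong (trans (θ-κ⊛ x X n) (⊛-congˡ (κ x) θX n)))) ⟩
    0# + (⊝ (κ x ⊛ X)) n                  ≈⟨ +-identityˡ _ ⟩
    (⊝ (κ x ⊛ X)) n                       ∎
    where
    θ𝟙 : θ 𝟙 ≋ 𝟘
    θ𝟙 zero    = zeroˡ _
    θ𝟙 (suc n) = zeroʳ _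
    θX : θ X ≋ X
    θX zero          = zeroˡ _
    θX (suc zero)    = trans (*-identityʳ _) (+-identityʳ _)
    θX (suc (suc n)) = zeroʳ _

  θ-cong : ∀ {f g} → f ≋ g → θ f ≋ θ g
  θ-cong f≋g n = *-congˡ (f≋g n)

  θ-[1-xz]⊛ : ∀ x f → θ ([1- x z] ⊛ f) ≋ ⊝ (κ x ⊛ X) ⊛ f ⊕ [1- x z] ⊛ θ f
  θ-[1-xz]⊛ x f n = trans (θ-⊛ [1- x z] f n) (+-congʳ (⊛-congʳ f (θ-[1-xz] x) n))

  [1-1z]≋1-X : [1- 1# z] ≋ 𝟙 ⊕ ⊝ X
  [1-1z]≋1-X n = +-congˡ (-‿cong (κ1⊛ X n))

  κ[1-x]≋1-κx : ∀ x → κ (1# - x) ≋ 𝟙 ⊕ ⊝ κ x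
  κ[1-x]≋1-κx x zero    = refl
  κ[1-x]≋1-κx x (suc n) = sym (trans (+-identityˡ _) -0#≈0#)

  module Dilation (q : Carrier) where

    σ : Series → Series
    σ f n = pow q n * f n

    σ-cong : ∀ {f g} → f ≋ g → σ f ≋ σ g
    σ-cong f≋g n = *-congˡ (f≋g n)

    σ-⊕ : ∀ f g → σ (f ⊕ g) ≋ σ f ⊕ σ g
    σ-⊕ f g n = distribˡ _ _ _

    σ-⊝ : ∀ f → σ (⊝ f) ≋ ⊝ σ f
    σ-⊝ f n = sym (-‿distribʳ-* _ _)

    σ-⊛ : ∀ f g → σ (f ⊛ g) ≋ σ f ⊛ σ g
    σ-⊛ f g n = trans (*-distribˡ-sumTo n _ _) (sumTo-cong n split)
      where
      split : ∀ i → i ≤ n → pow q n * (f i * g (n ∸ i)) ≈ (pow q i * f i) * (pow q (n ∸ i) * g (n ∸ i))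
      split i i≤n = trans (*-congʳ (trans (reflexive (≡.cong (pow q) (≡.sym (ℕ.m+[n∸m]≡n i≤n)))) (pow-+ q i (n ∸ i))))
        (Scalar.solve 4 (λ a b x y → (a :* b) :* (x :* y) := (a :* x) :* (b :* y)) refl (pow q i) (pow q (n ∸ i)) (f i) (g (n ∸ i)))

    σ-[1-xz] : ∀ x → σ [1- x z] ≋ [1- x * q z]
    σ-[1-xz] x n = begin
      σ [1- x z] n                          ≈⟨ σ-⊕ 𝟙 (⊝ (κ x ⊛ X)) n ⟩
      σ 𝟙 n + σ (⊝ (κ x ⊛ X)) n             ≈⟨ +-cong (σ𝟙 n) (trans (σ-⊝ (κ x ⊛ X) n) (-‿cong (σκ⊛X n))) ⟩
      [1- x * q z] n                        ∎
      where
      σ𝟙 : σ 𝟙 ≋ 𝟙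
      σ𝟙 zero    = *-identityˡ _
      σ𝟙 (suc n) = zeroʳ _
      σκ⊛X : σ (κ x ⊛ X) ≋ κ (x * q) ⊛ X
      σκ⊛X n = trans (*-congˡ (κ⊛ x X n)) (trans (coefficient n) (sym (κ⊛ (x * q) X n)))
        where
        coefficient : ∀ n → pow q n * (x * X n) ≈ x * q * X n
        coefficient zero          = trans (*-congˡ (zeroʳ x)) (trans (zeroʳ _) (sym (zeroʳ _)))
        coefficient (suc zero)    = Scalar.solve 2 (λ q x → (con (+ 1) :* q) :* (x :* con (+ 1)) := x :* q :* con (+ 1)) refl q x
        coefficient (suc (suc n)) = trans (*-congˡ (zeroʳ x)) (trans (zeroʳ _) (sym (zeroʳ _)))

    VanishesUpTo : ℕ → Series → Set ℓ
    VanishesUpTo n f = ∀ m → m ≤ n → f m ≈ 0#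

    σ-vanishesUpTo : ∀ {n f} → VanishesUpTo n f → VanishesUpTo n (σ f)
    σ-vanishesUpTo f≈0 m m≤n = trans (*-congˡ (f≈0 m m≤n)) (zeroʳ _)

    [1-xz]⊛-vanishesUpTo : ∀ x {n f} → VanishesUpTo n f → VanishesUpTo n ([1- x z] ⊛ f)
    [1-xz]⊛-vanishesUpTo x {f = f} f≈0 zero    m≤n = trans ([1-xz]⊛-zero x f) (f≈0 0 m≤n)
    [1-xz]⊛-vanishesUpTo x {f = f} f≈0 (suc m) m≤n = begin
      ([1- x z] ⊛ f) (suc m)    ≈⟨ [1-xz]⊛-suc x f m ⟩
      f (suc m) - x * f m       ≈⟨ +-cong (f≈0 (suc m) m≤n) (-‿cong (trans (*-congˡ (f≈0 m (ℕ.≤-trans (ℕ.n≤1+n m) m≤n))) (zeroʳ x))) ⟩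
      0# - 0#                   ≈⟨ -‿inverseʳ 0# ⟩
      0#                        ∎

    -- Once Y vanishes up to n, the coefficients of z^(n+1) give Y (n+1) ≈ q^(n+1) Y (n+1).
    q-difference-unique : (∀ k → ¬ (pow q (suc k) ≈ 1#)) → ∀ u v w Y → Y 0 ≈ 0# →
      [1- u z] ⊛ Y ≋ [1- v z] ⊛ ([1- w z] ⊛ σ Y) → Y ≋ 𝟘
    q-difference-unique q^k≉1 u v w Y Y₀≈0 eq n = vanishes n n ℕ.≤-refl
      where
      vanishes : ∀ n → VanishesUpTo n Y
      vanishes zero    .zero z≤n = Y₀≈0
      vanishes (suc n) m m≤1+n with ℕ.m≤n⇒m<n∨m≡n m≤1+n
      ... | inj₁ (s≤s m≤n) = vanishes n m m≤n
      ... | inj₂ ≡.refl    = x*u≈0⇒x≈0 1-q^[1+n]≉0 (begin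
          Y (suc n) * (1# - pow q (suc n))                        ≈⟨ Scalar.solve 2 (λ y p → y :* (con (+ 1) :- p) := y :- p :* y) refl (Y (suc n)) (pow q (suc n)) ⟩
          Y (suc n) - pow q (suc n) * Y (suc n)                   ≈⟨ +-congʳ fixed ⟩
          pow q (suc n) * Y (suc n) - pow q (suc n) * Y (suc n)   ≈⟨ -‿inverseʳ _ ⟩
          0#                                                      ∎)
        where
        Y≈0 : VanishesUpTo n Y
        Y≈0 = vanishes n
        G : Series
        G = [1- w z] ⊛ σ Y
        fixed : Y (suc n) ≈ pow q (suc n) * Y (suc n)
        fixed = begin
          Y (suc n)                       ≈⟨ sym (x-y*z≈x u (Y≈0 n ℕ.≤-refl)) ⟩
          Y (suc n) - u * Y n             ≈⟨ sym ([1-xz]⊛-suc u Y n) ⟩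
          ([1- u z] ⊛ Y) (suc n)          ≈⟨ eq (suc n) ⟩
          ([1- v z] ⊛ G) (suc n)          ≈⟨ [1-xz]⊛-suc v G n ⟩
          G (suc n) - v * G n             ≈⟨ x-y*z≈x v ([1-xz]⊛-vanishesUpTo w (σ-vanishesUpTo Y≈0) n ℕ.≤-refl) ⟩
          G (suc n)                       ≈⟨ [1-xz]⊛-suc w (σ Y) n ⟩
          σ Y (suc n) - w * σ Y n         ≈⟨ x-y*z≈x w (σ-vanishesUpTo Y≈0 n ℕ.≤-refl) ⟩
          pow q (suc n) * Y (suc n)       ∎
        1-q^[1+n]≉0 : ¬ (1# - pow q (suc n) ≈ 0#)
        1-q^[1+n]≉0 = 1-x≉0 (q^k≉1 n)

module QSeries {c ℓ} (F : Field c ℓ) (q : Field.Carrier F)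
  (q^k≉1 : ∀ k → ¬ (Field._≈_ F (FieldOps.pow F q (suc k)) (Field.1# F))) where
  open FieldOps F
  open FieldProperties F
  open PowerSeries F
  open Dilation q
  module ≈-Reasoning = Relation.Binary.Reasoning.Setoid setoid
  private
    module Scalar = IntegerCoefficients commutativeRing
    module SeriesSolver = IntegerCoefficients seriesRing
  open Scalar using (_:*_; :-_; _:-_; _:=_; con)

  qPochq⁻¹ : ℕ → Carrier
  qPochq⁻¹ n = qPoch q q n ⁻¹

  1-q^[1+n]≉0 : ∀ n → ¬ (1# - pow q (suc n) ≈ 0#)
  1-q^[1+n]≉0 n = 1-x≉0 (q^k≉1 n)

  qPochq≉0 : ∀ n → ¬ (qPoch q q n ≈ 0#)
  qPochq≉0 zero    = 1≉0
  qPochq≉0 (suc n) = *-nonzero (qPochq≉0 n) (λ e → 1-q^[1+n]≉0 n (trans (+-congˡ (-‿cong (*-comm _ _))) e))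

  qPochq⁻¹-zero : qPochq⁻¹ 0 ≈ 1#
  qPochq⁻¹-zero = 1⁻¹≈1

  qPochq⁻¹-suc : ∀ n → qPochq⁻¹ (suc n) * (1# - pow q (suc n)) ≈ qPochq⁻¹ n
  qPochq⁻¹-suc n = begin
    (qPoch q q n * u′) ⁻¹ * u                ≈⟨ *-cong (⁻¹-distrib-* (qPochq≉0 n) u′≉0) u≈u′ ⟩
    (qPoch q q n ⁻¹ * u′ ⁻¹) * u′            ≈⟨ *-assoc _ _ _ ⟩
    qPoch q q n ⁻¹ * (u′ ⁻¹ * u′)            ≈⟨ *-congˡ (⁻¹-inverseˡ u′ u′≉0) ⟩
    qPoch q q n ⁻¹ * 1#                      ≈⟨ *-identityʳ _ ⟩
    qPochq⁻¹ n                               ∎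
    where
    open ≈-Reasoning
    u u′ : Carrier
    u = 1# - pow q (suc n)
    u′ = 1# - q * pow q n
    u≈u′ : u ≈ u′
    u≈u′ = +-congˡ (-‿cong (*-comm _ _))
    u′≉0 : ¬ (u′ ≈ 0#)
    u′≉0 e = 1-q^[1+n]≉0 n (trans u≈u′ e)

  cancel-1-q^[1+n] : ∀ n {y z} → y * (1# - pow q (suc n)) ≈ z * (1# - pow q (suc n)) → y ≈ z
  cancel-1-q^[1+n] n = *-cancelʳ (1-q^[1+n]≉0 n)

  -- qbin x = Σ (x;q)ₙ/(q;q)ₙ zⁿ = (xz;q)∞/(z;q)∞ and euler x = Σ (-x)ⁿ q^(n(n-1)/2)/(q;q)ₙ zⁿ = (xz;q)∞.
  qbin : Carrier → Series
  qbin x n = qPoch x q n * qPochq⁻¹ n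

  euler : Carrier → Series
  euler x n = pow (- x) n * pow q (triangle n) * qPochq⁻¹ n

  qbin-zero : ∀ x → qbin x 0 ≈ 1#
  qbin-zero x = trans (*-identityˡ _) qPochq⁻¹-zero

  euler-zero : ∀ x → euler x 0 ≈ 1#
  euler-zero x = trans (*-congʳ (*-identityˡ 1#)) (trans (*-identityˡ _) qPochq⁻¹-zero)

  qbin-suc : ∀ x n → qbin x (suc n) * (1# - pow q (suc n)) ≈ qbin x n * (1# - x * pow q n)
  qbin-suc x n = begin
    (P * t) * qPochq⁻¹ (suc n) * u       ≈⟨ *-assoc _ _ _ ⟩
    (P * t) * (qPochq⁻¹ (suc n) * u)     ≈⟨ *-congˡ (qPochq⁻¹-suc n) ⟩
    (P * t) * qPochq⁻¹ n                 ≈⟨ trans (*-assoc _ _ _) (trans (*-congˡ (*-comm _ _)) (sym (*-assoc _ _ _))) ⟩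
    P * qPochq⁻¹ n * t                   ∎
    where
    open ≈-Reasoning
    P t u : Carrier
    P = qPoch x q n
    t = 1# - x * pow q n
    u = 1# - pow q (suc n)

  qbin-suc-shift : ∀ x n → qbin x (suc n) * (1# - pow q (suc n)) ≈ (1# - x) * qbin (x * q) n
  qbin-suc-shift x n = begin
    qPoch x q (suc n) * qPochq⁻¹ (suc n) * u        ≈⟨ *-assoc _ _ _ ⟩
    qPoch x q (suc n) * (qPochq⁻¹ (suc n) * u)      ≈⟨ *-cong (qPoch-suc-shift x q n) (qPochq⁻¹-suc n) ⟩
    (1# - x) * qPoch (x * q) q n * qPochq⁻¹ n       ≈⟨ *-assoc _ _ _ ⟩
    (1# - x) * qbin (x * q) n                       ∎
    where
    open ≈-Reasoning
    u : Carrier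
    u = 1# - pow q (suc n)

  euler-suc : ∀ x n → euler x (suc n) * (1# - pow q (suc n)) ≈ - x * pow q n * euler x n
  euler-suc x n = begin
    m * - x * pow q (n +ℕ triangle n) * qPochq⁻¹ (suc n) * u   ≈⟨ *-assoc _ _ _ ⟩
    m * - x * pow q (n +ℕ triangle n) * (qPochq⁻¹ (suc n) * u) ≈⟨ *-cong (*-congˡ (pow-+ q n (triangle n))) (qPochq⁻¹-suc n) ⟩
    m * - x * (r * e) * qPochq⁻¹ n                              ≈⟨ Scalar.solve 5 (λ m y r e i → m :* y :* (r :* e) :* i := y :* r :* (m :* e :* i)) refl m (- x) r e (qPochq⁻¹ n) ⟩
    - x * r * euler x n                                          ∎
    where
    open ≈-Reasoning
    m r e u : Carrier
    m = pow (- x) n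
    r = pow q n
    e = pow q (triangle n)
    u = 1# - pow q (suc n)

  qbin-functional : ∀ x → [1- 1# z] ⊛ qbin x ≋ [1- x z] ⊛ σ (qbin x)
  qbin-functional x zero = begin
    ([1- 1# z] ⊛ qbin x) 0        ≈⟨ [1-xz]⊛-zero 1# (qbin x) ⟩
    qbin x 0                      ≈⟨ sym (*-identityˡ _) ⟩
    σ (qbin x) 0                  ≈⟨ sym ([1-xz]⊛-zero x (σ (qbin x))) ⟩
    ([1- x z] ⊛ σ (qbin x)) 0     ∎
    where open ≈-Reasoning
  qbin-functional x (suc n) = begin
    ([1- 1# z] ⊛ qbin x) (suc n)           ≈⟨ [1-xz]⊛-suc 1# (qbin x) n ⟩
    A - 1# * B                             ≈⟨ cancel-1-q^[1+n] n (begin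
      (A - 1# * B) * u                       ≈⟨ Scalar.solve 4 (λ A B r q → (A :- con (+ 1) :* B) :* (con (+ 1) :- r :* q) := A :* (con (+ 1) :- r :* q) :- B :* (con (+ 1) :- r :* q)) refl A B r q ⟩
      A * u - B * u                          ≈⟨ +-congʳ (qbin-suc x n) ⟩
      B * (1# - x * r) - B * u               ≈⟨ Scalar.solve 4 (λ B x r q → B :* (con (+ 1) :- x :* r) :- B :* (con (+ 1) :- r :* q) := (r :* q) :* (B :* (con (+ 1) :- x :* r)) :- x :* (r :* B) :* (con (+ 1) :- r :* q)) refl B x r q ⟩
      p * (B * (1# - x * r)) - x * (r * B) * u ≈⟨ +-congʳ (*-congˡ (sym (qbin-suc x n))) ⟩
      p * (A * u) - x * (r * B) * u          ≈⟨ Scalar.solve 5 (λ A B x r q → (r :* q) :* (A :* (con (+ 1) :- r :* q)) :- x :* (r :* B) :* (con (+ 1) :- r :* q) := ((r :* q) :* A :- x :* (r :* B)) :* (con (+ 1) :- r :* q)) refl A B x r q ⟩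
      (p * A - x * (r * B)) * u              ∎) ⟩
    p * A - x * (r * B)                    ≈⟨ sym ([1-xz]⊛-suc x (σ (qbin x)) n) ⟩
    ([1- x z] ⊛ σ (qbin x)) (suc n)        ∎
    where
    open ≈-Reasoning
    A B r p u : Carrier
    A = qbin x (suc n)
    B = qbin x n
    r = pow q n
    p = pow q (suc n)
    u = 1# - pow q (suc n)

  qbin-shift : ∀ x → [1- 1# z] ⊛ qbin (x * q) ≋ σ (qbin x)
  qbin-shift x zero = begin
    ([1- 1# z] ⊛ qbin (x * q)) 0     ≈⟨ [1-xz]⊛-zero 1# (qbin (x * q)) ⟩
    qbin (x * q) 0                   ≈⟨ trans (qbin-zero (x * q)) (sym (qbin-zero x)) ⟩
    qbin x 0                         ≈⟨ sym (*-identityˡ _) ⟩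
    σ (qbin x) 0                     ∎
    where open ≈-Reasoning
  qbin-shift x (suc n) = begin
    ([1- 1# z] ⊛ qbin (x * q)) (suc n)     ≈⟨ [1-xz]⊛-suc 1# (qbin (x * q)) n ⟩
    K′ - 1# * K                            ≈⟨ cancel-1-q^[1+n] n (begin
      (K′ - 1# * K) * u                      ≈⟨ Scalar.solve 4 (λ K′ K r q → (K′ :- con (+ 1) :* K) :* (con (+ 1) :- r :* q) := K′ :* (con (+ 1) :- r :* q) :- K :* (con (+ 1) :- r :* q)) refl K′ K r q ⟩
      K′ * u - K * u                         ≈⟨ +-congʳ (qbin-suc (x * q) n) ⟩
      K * (1# - x * q * r) - K * u           ≈⟨ Scalar.solve 4 (λ K x r q → K :* (con (+ 1) :- x :* q :* r) :- K :* (con (+ 1) :- r :* q) := (r :* q) :* ((con (+ 1) :- x) :* K)) refl K x r q ⟩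
      p * ((1# - x) * K)                     ≈⟨ *-congˡ (sym (qbin-suc-shift x n)) ⟩
      p * (qbin x (suc n) * u)               ≈⟨ sym (*-assoc _ _ _) ⟩
      p * qbin x (suc n) * u                 ∎) ⟩
    σ (qbin x) (suc n)                     ∎
    where
    open ≈-Reasoning
    K′ K r p u : Carrier
    K′ = qbin (x * q) (suc n)
    K = qbin (x * q) n
    r = pow q n
    p = pow q (suc n)
    u = 1# - pow q (suc n)

  euler-functional : ∀ x → euler x ≋ [1- x z] ⊛ σ (euler x)
  euler-functional x zero = begin
    euler x 0                       ≈⟨ sym (*-identityˡ _) ⟩
    σ (euler x) 0                   ≈⟨ sym ([1-xz]⊛-zero x (σ (euler x))) ⟩
    ([1- x z] ⊛ σ (euler x)) 0      ∎
    where open ≈-Reasoning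
  euler-functional x (suc n) = begin
    E′                                     ≈⟨ cancel-1-q^[1+n] n (begin
      E′ * u                                 ≈⟨ euler-suc x n ⟩
      - x * r * E                            ≈⟨ Scalar.solve 4 (λ E x r q → :- x :* r :* E := (r :* q) :* (:- x :* r :* E) :- x :* (r :* E) :* (con (+ 1) :- r :* q)) refl E x r q ⟩
      p * (- x * r * E) - x * (r * E) * u    ≈⟨ +-congʳ (*-congˡ (sym (euler-suc x n))) ⟩
      p * (E′ * u) - x * (r * E) * u         ≈⟨ Scalar.solve 5 (λ E′ E x r q → (r :* q) :* (E′ :* (con (+ 1) :- r :* q)) :- x :* (r :* E) :* (con (+ 1) :- r :* q) := ((r :* q) :* E′ :- x :* (r :* E)) :* (con (+ 1) :- r :* q)) refl E′ E x r q ⟩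
      (p * E′ - x * (r * E)) * u             ∎) ⟩
    p * E′ - x * (r * E)                   ≈⟨ sym ([1-xz]⊛-suc x (σ (euler x)) n) ⟩
    ([1- x z] ⊛ σ (euler x)) (suc n)       ∎
    where
    open ≈-Reasoning
    E′ E r p u : Carrier
    E′ = euler x (suc n)
    E = euler x n
    r = pow q n
    p = pow q (suc n)
    u = 1# - pow q (suc n)

  open SeriesSolver using () renaming (_:+_ to _⊞_; _:*_ to _⊠_; _:-_ to _⊟_; :-_ to ⊟_; _:=_ to _≐_; con to scon)

  σ-qbin-functional : ∀ x → [1- 1# * q z] ⊛ σ (qbin x) ≋ [1- x * q z] ⊛ σ (σ (qbin x))
  σ-qbin-functional x = begin
    [1- 1# * q z] ⊛ σ (qbin x)             ≈⟨ ⊛-congʳ (σ (qbin x)) (≋-sym (σ-[1-xz] 1#)) ⟩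
    σ [1- 1# z] ⊛ σ (qbin x)               ≈⟨ ≋-sym (σ-⊛ [1- 1# z] (qbin x)) ⟩
    σ ([1- 1# z] ⊛ qbin x)                 ≈⟨ σ-cong (qbin-functional x) ⟩
    σ ([1- x z] ⊛ σ (qbin x))              ≈⟨ σ-⊛ [1- x z] (σ (qbin x)) ⟩
    σ [1- x z] ⊛ σ (σ (qbin x))            ≈⟨ ⊛-congʳ (σ (σ (qbin x))) (σ-[1-xz] x) ⟩
    [1- x * q z] ⊛ σ (σ (qbin x))          ∎
    where open ≋-Reasoning

  euler-qbin-product : ∀ x → euler 1# ⊛ σ (qbin x) ≋ [1- 1# z] ⊛ euler (x * q)
  euler-qbin-product x n = x∙y⁻¹≈ε⇒x≈y _ _ (q-difference-unique q^k≉1 (1# * q) 1# (x * q) Y Y₀≈0 recurrence n)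
    where
    open import Algebra.Properties.Ring ring using (x∙y⁻¹≈ε⇒x≈y)
    E a H Y : Series
    E = euler 1#
    a = σ (qbin x)
    H = euler (x * q)
    Y = E ⊛ a ⊕ ⊝ ([1- 1# z] ⊛ H)
    Y₀≈0 : Y 0 ≈ 0#
    Y₀≈0 = begin
      E 0 * a 0 - ([1- 1# z] ⊛ H) 0      ≈⟨ +-cong (*-cong (euler-zero 1#) (trans (*-identityˡ _) (qbin-zero x))) (-‿cong (trans ([1-xz]⊛-zero 1# H) (euler-zero (x * q)))) ⟩
      1# * 1# - 1#                       ≈⟨ +-congʳ (*-identityˡ 1#) ⟩
      1# - 1#                            ≈⟨ -‿inverseʳ 1# ⟩
      0#                                 ∎
      where open ≈-Reasoning
    σY : σ Y ≋ σ E ⊛ σ a ⊕ ⊝ ([1- 1# * q z] ⊛ σ H)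
    σY = begin
      σ Y                                              ≈⟨ σ-⊕ (E ⊛ a) _ ⟩
      σ (E ⊛ a) ⊕ σ (⊝ ([1- 1# z] ⊛ H))               ≈⟨ ⊕-cong (σ-⊛ E a) (≋-trans (σ-⊝ _) (⊝-cong (≋-trans (σ-⊛ [1- 1# z] H) (⊛-congʳ (σ H) (σ-[1-xz] 1#))))) ⟩
      σ E ⊛ σ a ⊕ ⊝ ([1- 1# * q z] ⊛ σ H)             ∎
      where open ≋-Reasoning
    recurrence : [1- 1# * q z] ⊛ Y ≋ [1- 1# z] ⊛ ([1- x * q z] ⊛ σ Y)
    recurrence = begin
      [1- 1# * q z] ⊛ Y
        ≈⟨ SeriesSolver.solve 5 (λ l c a m h → l ⊠ (c ⊠ a ⊟ m ⊠ h) ≐ c ⊠ (l ⊠ a) ⊟ l ⊠ (m ⊠ h)) (λ _ → refl) [1- 1# * q z] E a [1- 1# z] H ⟩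
      E ⊛ ([1- 1# * q z] ⊛ a) ⊕ ⊝ ([1- 1# * q z] ⊛ ([1- 1# z] ⊛ H))
        ≈⟨ ⊕-cong (⊛-cong (euler-functional 1#) (σ-qbin-functional x)) (⊝-cong (⊛-congˡ [1- 1# * q z] (⊛-congˡ [1- 1# z] (euler-functional (x * q))))) ⟩
      ([1- 1# z] ⊛ σ E) ⊛ ([1- x * q z] ⊛ σ a) ⊕ ⊝ ([1- 1# * q z] ⊛ ([1- 1# z] ⊛ ([1- x * q z] ⊛ σ H)))
        ≈⟨ SeriesSolver.solve 6 (λ m sc w sa l sh → (m ⊠ sc) ⊠ (w ⊠ sa) ⊟ l ⊠ (m ⊠ (w ⊠ sh)) ≐ m ⊠ (w ⊠ (sc ⊠ sa ⊟ l ⊠ sh))) (λ _ → refl) [1- 1# z] (σ E) [1- x * q z] (σ a) [1- 1# * q z] (σ H) ⟩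
      [1- 1# z] ⊛ ([1- x * q z] ⊛ (σ E ⊛ σ a ⊕ ⊝ ([1- 1# * q z] ⊛ σ H)))
        ≈⟨ ⊛-congˡ [1- 1# z] (⊛-congˡ [1- x * q z] (≋-sym σY)) ⟩
      [1- 1# z] ⊛ ([1- x * q z] ⊛ σ Y) ∎
      where open ≋-Reasoning

  module Wronskian (x : Carrier) where
    a b W : Series
    a = qbin x
    b = σ a
    W = θ a ⊛ b ⊕ ⊝ (a ⊛ θ b)

    [1-z]⊛θa : [1- 1# z] ⊛ θ a ≋ X ⊛ a ⊕ [1- x z] ⊛ θ b ⊕ ⊝ (κ x ⊛ X ⊛ b)
    [1-z]⊛θa = begin
      [1- 1# z] ⊛ θ a
        ≈⟨ SeriesSolver.solve 4 (λ l t k a → l ⊠ t ≐ (⊟ k ⊠ a ⊞ l ⊠ t) ⊞ k ⊠ a) (λ _ → refl) [1- 1# z] (θ a) (κ 1# ⊛ X) a ⟩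
      (⊝ (κ 1# ⊛ X) ⊛ a ⊕ [1- 1# z] ⊛ θ a) ⊕ κ 1# ⊛ X ⊛ a
        ≈⟨ ⊕-cong (≋-sym (θ-[1-xz]⊛ 1# a)) (⊛-congʳ a (κ1⊛ X)) ⟩
      θ ([1- 1# z] ⊛ a) ⊕ X ⊛ a
        ≈⟨ ⊕-cong (≋-trans (θ-cong (qbin-functional x)) (θ-[1-xz]⊛ x b)) ≋-refl ⟩
      (⊝ (κ x ⊛ X) ⊛ b ⊕ [1- x z] ⊛ θ b) ⊕ X ⊛ a
        ≈⟨ SeriesSolver.solve 6 (λ k z b l t a → (⊟ (k ⊠ z) ⊠ b ⊞ l ⊠ t) ⊞ z ⊠ a ≐ z ⊠ a ⊞ l ⊠ t ⊟ k ⊠ z ⊠ b) (λ _ → refl) (κ x) X b [1- x z] (θ b) a ⟩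
      X ⊛ a ⊕ [1- x z] ⊛ θ b ⊕ ⊝ (κ x ⊛ X ⊛ b) ∎
      where open ≋-Reasoning

    [1-z]⊛W : [1- 1# z] ⊛ W ≋ X ⊛ b ⊛ (a ⊕ ⊝ (κ x ⊛ b))
    [1-z]⊛W = begin
      [1- 1# z] ⊛ W
        ≈⟨ SeriesSolver.solve 5 (λ l ta b a tb → l ⊠ (ta ⊠ b ⊟ a ⊠ tb) ≐ (l ⊠ ta) ⊠ b ⊟ (l ⊠ a) ⊠ tb) (λ _ → refl) [1- 1# z] (θ a) b a (θ b) ⟩
      ([1- 1# z] ⊛ θ a) ⊛ b ⊕ ⊝ (([1- 1# z] ⊛ a) ⊛ θ b)
        ≈⟨ ⊕-cong (⊛-congʳ b [1-z]⊛θa) (⊝-cong (⊛-congʳ (θ b) (qbin-functional x))) ⟩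
      (X ⊛ a ⊕ [1- x z] ⊛ θ b ⊕ ⊝ (κ x ⊛ X ⊛ b)) ⊛ b ⊕ ⊝ (([1- x z] ⊛ b) ⊛ θ b)
        ≈⟨ SeriesSolver.solve 6 (λ z a l tb k b → (z ⊠ a ⊞ l ⊠ tb ⊟ k ⊠ z ⊠ b) ⊠ b ⊟ (l ⊠ b) ⊠ tb ≐ z ⊠ b ⊠ (a ⊟ k ⊠ b)) (λ _ → refl) X a [1- x z] (θ b) (κ x) b ⟩
      X ⊛ b ⊛ (a ⊕ ⊝ (κ x ⊛ b)) ∎
      where open ≋-Reasoning

    [1-z]²⊛W : [1- 1# z] ⊛ ([1- 1# z] ⊛ W) ≋ κ (1# - x) ⊛ (X ⊛ (b ⊛ b))
    [1-z]²⊛W = begin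
      [1- 1# z] ⊛ ([1- 1# z] ⊛ W)
        ≈⟨ ⊛-congˡ [1- 1# z] [1-z]⊛W ⟩
      [1- 1# z] ⊛ (X ⊛ b ⊛ (a ⊕ ⊝ (κ x ⊛ b)))
        ≈⟨ SeriesSolver.solve 5 (λ l z b a k → l ⊠ (z ⊠ b ⊠ (a ⊟ k ⊠ b)) ≐ z ⊠ b ⊠ (l ⊠ a ⊟ k ⊠ (l ⊠ b))) (λ _ → refl) [1- 1# z] X b a (κ x) ⟩
      X ⊛ b ⊛ ([1- 1# z] ⊛ a ⊕ ⊝ (κ x ⊛ ([1- 1# z] ⊛ b)))
        ≈⟨ ⊛-congˡ (X ⊛ b) (⊕-cong (qbin-functional x) (⊝-cong (⊛-congˡ (κ x) (⊛-congʳ b [1-1z]≋1-X)))) ⟩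
      X ⊛ b ⊛ ([1- x z] ⊛ b ⊕ ⊝ (κ x ⊛ ((𝟙 ⊕ ⊝ X) ⊛ b)))
        ≈⟨ SeriesSolver.solve 3 (λ z b k → z ⊠ b ⊠ ((scon (+ 1) ⊟ k ⊠ z) ⊠ b ⊟ k ⊠ ((scon (+ 1) ⊟ z) ⊠ b)) ≐ (scon (+ 1) ⊟ k) ⊠ (z ⊠ (b ⊠ b))) (λ _ → refl) X b (κ x) ⟩
      (𝟙 ⊕ ⊝ κ x) ⊛ (X ⊛ (b ⊛ b))
        ≈⟨ ⊛-congʳ (X ⊛ (b ⊛ b)) (≋-sym (κ[1-x]≋1-κx x)) ⟩
      κ (1# - x) ⊛ (X ⊛ (b ⊛ b)) ∎
      where open ≋-Reasoning

    euler⊛W : euler 1# ⊛ W ≋ κ (1# - x) ⊛ (X ⊛ (euler (x * q) ⊛ qbin (x * q)))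
    euler⊛W = [1-xz]⊛-cancel 1# ([1-xz]⊛-cancel 1# (begin
      [1- 1# z] ⊛ ([1- 1# z] ⊛ (E ⊛ W))
        ≈⟨ SeriesSolver.solve 3 (λ l c w → l ⊠ (l ⊠ (c ⊠ w)) ≐ c ⊠ (l ⊠ (l ⊠ w))) (λ _ → refl) [1- 1# z] E W ⟩
      E ⊛ ([1- 1# z] ⊛ ([1- 1# z] ⊛ W))
        ≈⟨ ⊛-congˡ E [1-z]²⊛W ⟩
      E ⊛ (κ (1# - x) ⊛ (X ⊛ (b ⊛ b)))
        ≈⟨ SeriesSolver.solve 4 (λ c k z b → c ⊠ (k ⊠ (z ⊠ (b ⊠ b))) ≐ k ⊠ (z ⊠ ((c ⊠ b) ⊠ b))) (λ _ → refl) E (κ (1# - x)) X b ⟩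
      κ (1# - x) ⊛ (X ⊛ ((E ⊛ b) ⊛ b))
        ≈⟨ ⊛-congˡ (κ (1# - x)) (⊛-congˡ X (⊛-cong (euler-qbin-product x) (≋-sym (qbin-shift x)))) ⟩
      κ (1# - x) ⊛ (X ⊛ (([1- 1# z] ⊛ H) ⊛ ([1- 1# z] ⊛ K)))
        ≈⟨ SeriesSolver.solve 5 (λ l h k κ z → κ ⊠ (z ⊠ ((l ⊠ h) ⊠ (l ⊠ k))) ≐ l ⊠ (l ⊠ (κ ⊠ (z ⊠ (h ⊠ k))))) (λ _ → refl) [1- 1# z] H K (κ (1# - x)) X ⟩
      [1- 1# z] ⊛ ([1- 1# z] ⊛ (κ (1# - x) ⊛ (X ⊛ (H ⊛ K)))) ∎))
      where
      open ≋-Reasoning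
      E H K : Series
      E = euler 1#
      H = euler (x * q)
      K = qbin (x * q)

module Theorem6p2 {c ℓ} (F : Field c ℓ) (q d : Field.Carrier F)
  (q≉0 : ¬ (Field._≈_ F q (Field.0# F)))
  (q^k≉1 : ∀ k → ¬ (Field._≈_ F (FieldOps.pow F q (suc k)) (Field.1# F)))
  (d≉q² : ¬ (Field._≈_ F d (FieldOps.pow F q 2))) where
  open FieldOps F
  open FieldProperties F
  open FiniteSums F
  open PowerSeries F
  open import Relation.Binary.Reasoning.Setoid setoid
  private module Scalar = IntegerCoefficients commutativeRing
  open Scalar using (_:+_; _:*_; :-_; _:-_; _:=_; con)

  D : Carrier
  D = d * pow q 2 ⁻¹

  open QSeries F q q^k≉1
  open Wronskian D

  G : Series
  G = euler (D * q) ⊛ qbin (D * q)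

  q²≉0 : ¬ (pow q 2 ≈ 0#)
  q²≉0 = pow-nonzero q≉0 2

  d/q≈D*q : d * q ⁻¹ ≈ D * q
  d/q≈D*q = begin
    d * q ⁻¹                   ≈⟨ *-congˡ (sym (⁻¹-unique q≉0 q*[q²⁻¹*q]≈1)) ⟩
    d * (pow q 2 ⁻¹ * q)       ≈⟨ sym (*-assoc _ _ _) ⟩
    D * q                      ∎
    where
    q*[q²⁻¹*q]≈1 : q * (pow q 2 ⁻¹ * q) ≈ 1#
    q*[q²⁻¹*q]≈1 = trans (Scalar.solve 2 (λ q i → q :* (i :* q) := i :* (con (+ 1) :* q :* q)) refl q (pow q 2 ⁻¹)) (⁻¹-inverseˡ _ q²≉0)

  1-D≉0 : ¬ (1# - D ≈ 0#)
  1-D≉0 1-D≈0 = d≉q² (begin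
    d                          ≈⟨ sym (*-identityʳ d) ⟩
    d * 1#                     ≈⟨ *-congˡ (sym (⁻¹-inverseˡ _ q²≉0)) ⟩
    d * (pow q 2 ⁻¹ * pow q 2) ≈⟨ sym (*-assoc _ _ _) ⟩
    D * pow q 2                ≈⟨ *-congʳ (sym (x∙y⁻¹≈ε⇒x≈y _ _ 1-D≈0)) ⟩
    1# * pow q 2               ≈⟨ *-identityˡ _ ⟩
    pow q 2                    ∎)
    where open import Algebra.Properties.Ring ring using (x∙y⁻¹≈ε⇒x≈y)

  lhs-summand : ℕ → ℕ → Carrier
  lhs-summand j n = gauss q j n * qPoch (d * q ⁻¹) q (j ∸ n) * pow (- (d * q ⁻¹)) n * pow q ⌊ n *ℕ (n ∸ 1) /2⌋

  rhs-summand : ℕ → ℕ → ℕ → Carrier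
  rhs-summand j t n =
    ((ι (2 *ℕ n) - ι t) * qPoch D q n * qPoch D q (t ∸ n) * pow (- 1#) (suc j ∸ t)
        * pow q ((t ∸ n) +ℕ ⌊ (j ∸ t) *ℕ suc (j ∸ t) /2⌋))
      * ((qPoch q q n * qPoch q q (t ∸ n) * qPoch q q (suc j ∸ t)) ⁻¹)

  lhs-term : ∀ j n → lhs-summand j n ≈ qPoch q q j * (euler (D * q) n * qbin (D * q) (j ∸ n))
  lhs-term j n = begin
    gauss q j n * qPoch (d * q ⁻¹) q m * pow (- (d * q ⁻¹)) n * pow q ⌊ n *ℕ (n ∸ 1) /2⌋
      ≈⟨ *-cong (*-cong (*-cong (*-congˡ (⁻¹-distrib-* (qPochq≉0 n) (qPochq≉0 m))) (qPoch-cong q m d/q≈D*q))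
                         (pow-cong n (-‿cong d/q≈D*q)))
                (reflexive (≡.cong (pow q) (⌊n*[n∸1]/2⌋≡triangle n))) ⟩
    qPoch q q j * (qPochq⁻¹ n * qPochq⁻¹ m) * qPoch (D * q) q m * pow (- (D * q)) n * pow q (triangle n)
      ≈⟨ Scalar.solve 6 (λ P i i′ R s t → P :* (i :* i′) :* R :* s :* t := P :* ((s :* t :* i) :* (R :* i′)))
           refl (qPoch q q j) (qPochq⁻¹ n) (qPochq⁻¹ m) (qPoch (D * q) q m) (pow (- (D * q)) n) (pow q (triangle n)) ⟩
    qPoch q q j * (euler (D * q) n * qbin (D * q) m) ∎
    where
    m : ℕ
    m = j ∸ n

  lhs : ∀ j → sumTo j (lhs-summand j) ≈ qPoch q q j * G j
  lhs j = trans (sumTo-cong j (λ n _ → lhs-term j n)) (sym (*-distribˡ-sumTo j _ _))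

  -- The weight 2n - t = n - (t - n) is split between the two products forming W.
  rhs-term : ∀ j t n → n ≤ t →
    rhs-summand j t n ≈ (θ a n * b (t ∸ n) + - (a n * θ b (t ∸ n))) * euler 1# (suc j ∸ t)
  rhs-term j t n n≤t = begin
    ((ι (2 *ℕ n) - ι t) * qPoch D q n * qPoch D q m * pow (- 1#) k * pow q (m +ℕ ⌊ (j ∸ t) *ℕ suc (j ∸ t) /2⌋))
      * ((qPoch q q n * qPoch q q m * qPoch q q k) ⁻¹)
      ≈⟨ *-cong (*-cong (*-congʳ (*-congʳ (*-congʳ (+-cong 2n≈n+n (-‿cong t≈n+m))))) q-power) inverse ⟩
    (((ι n + ι n) - (ι n + ι m)) * qPoch D q n * qPoch D q m * pow (- 1#) k * (pow q m * pow q (triangle k)))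
      * (qPochq⁻¹ n * qPochq⁻¹ m * qPochq⁻¹ k)
      ≈⟨ Scalar.solve 10 (λ ιn ιm A B s r e i i′ i″ →
           ((ιn :+ ιn) :- (ιn :+ ιm)) :* A :* B :* s :* (r :* e) :* (i :* i′ :* i″)
           := (ιn :* (A :* i) :* (r :* (B :* i′)) :+ (:- ((A :* i) :* (ιm :* (r :* (B :* i′)))))) :* (s :* e :* i″))
           refl (ι n) (ι m) (qPoch D q n) (qPoch D q m) (pow (- 1#) k) (pow q m) (pow q (triangle k)) (qPochq⁻¹ n) (qPochq⁻¹ m) (qPochq⁻¹ k) ⟩
    (θ a n * b m + - (a n * θ b m)) * euler 1# k ∎
    where
    m k : ℕ
    m = t ∸ n
    k = suc j ∸ t
    2n≈n+n : ι (2 *ℕ n) ≈ ι n + ι n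
    2n≈n+n = trans (ι-+ n (n +ℕ 0)) (+-congˡ (reflexive (≡.cong ι (ℕ.+-identityʳ n))))
    t≈n+m : ι t ≈ ι n + ι m
    t≈n+m = trans (reflexive (≡.cong ι (≡.sym (ℕ.m+[n∸m]≡n n≤t)))) (ι-+ n m)
    q-power : pow q (m +ℕ ⌊ (j ∸ t) *ℕ suc (j ∸ t) /2⌋) ≈ pow q m * pow q (triangle k)
    q-power = trans (pow-+ q m _) (*-congˡ (reflexive (≡.cong (pow q)
      (≡.trans (≡.cong (λ i → ⌊ i *ℕ suc i /2⌋) (m∸n≡[1+m∸n]∸1 j t)) (⌊[n∸1]*suc[n∸1]/2⌋≡triangle k)))))
    inverse : (qPoch q q n * qPoch q q m * qPoch q q k) ⁻¹ ≈ qPochq⁻¹ n * qPochq⁻¹ m * qPochq⁻¹ k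
    inverse = trans (⁻¹-distrib-* (*-nonzero (qPochq≉0 n) (qPochq≉0 m)) (qPochq≉0 k))
                    (*-congʳ (⁻¹-distrib-* (qPochq≉0 n) (qPochq≉0 m)))

  rhs : ∀ j → sumTo (suc j) (λ t → sumTo t (rhs-summand j t)) ≈ (1# - D) * G j
  rhs j = begin
    sumTo (suc j) (λ t → sumTo t (rhs-summand j t)) ≈⟨ sumTo-cong (suc j) (λ t _ → inner t) ⟩
    (W ⊛ euler 1#) (suc j)                     ≈⟨ ⊛-comm W (euler 1#) (suc j) ⟩
    (euler 1# ⊛ W) (suc j)                     ≈⟨ euler⊛W (suc j) ⟩
    (κ (1# - D) ⊛ (X ⊛ G)) (suc j)             ≈⟨ κ⊛ (1# - D) (X ⊛ G) (suc j) ⟩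
    (1# - D) * (X ⊛ G) (suc j)                 ≈⟨ *-congˡ (X⊛-suc G j) ⟩
    (1# - D) * G j                             ∎
    where
    inner : ∀ t → sumTo t (rhs-summand j t) ≈ W t * euler 1# (suc j ∸ t)
    inner t = begin
      sumTo t (rhs-summand j t) ≈⟨ sumTo-cong t (rhs-term j t) ⟩
      sumTo t (λ n → (θ a n * b (t ∸ n) + - (a n * θ b (t ∸ n))) * euler 1# (suc j ∸ t))
        ≈⟨ sym (*-distribʳ-sumTo t _ _) ⟩
      sumTo t (λ n → θ a n * b (t ∸ n) + - (a n * θ b (t ∸ n))) * euler 1# (suc j ∸ t)
        ≈⟨ *-congʳ (trans (sumTo-distrib-+ t _ _) (+-congˡ (sym (-‿distrib-sumTo t _)))) ⟩
      W t * euler 1# (suc j ∸ t) ∎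

theorem6p2 : ∀ {c ℓ} (F : Field c ℓ) → let open FieldOps F in
  (q d : Carrier) → ¬ (q ≈ 0#) → (∀ k → ¬ (pow q (suc k) ≈ 1#)) →
  ¬ (d ≈ pow q 2) → (j : ℕ) →
  sumTo j (λ n →
      gauss q j n * qPoch (d * q ⁻¹) q (j ∸ n)
        * pow (- (d * q ⁻¹)) n * pow q ⌊ n *ℕ (n ∸ 1) /2⌋)
  ≈
  (qPoch q q j * ((1# - d * (pow q 2) ⁻¹) ⁻¹))
    * sumTo (suc j) (λ t → sumTo t (λ n →
        ((ι (2 *ℕ n) - ι t) * qPoch (d * (pow q 2) ⁻¹) q n
           * qPoch (d * (pow q 2) ⁻¹) q (t ∸ n)
           * pow (- 1#) (suc j ∸ t)
           * pow q ((t ∸ n) +ℕ ⌊ (j ∸ t) *ℕ suc (j ∸ t) /2⌋))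
        * ((qPoch q q n * qPoch q q (t ∸ n) * qPoch q q (suc j ∸ t)) ⁻¹)))
theorem6p2 F q d q≉0 q^k≉1 d≉q² j = begin
  sumTo j (lhs-summand j)                                      ≈⟨ lhs j ⟩
  qPoch q q j * G j                                            ≈⟨ x*y≈[x*u⁻¹]*[u*y] 1-D≉0 ⟩
  (qPoch q q j * (1# - D) ⁻¹) * ((1# - D) * G j)               ≈⟨ *-congˡ (sym (rhs j)) ⟩
  (qPoch q q j * (1# - D) ⁻¹) * sumTo (suc j) (λ t → sumTo t (rhs-summand j t)) ∎
  where
  open FieldOps F
  open FieldProperties F
  open Theorem6p2 F q d q≉0 q^k≉1 d≉q²
  open import Relation.Binary.Reasoning.Setoid setoid
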